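{- Let $\mathcal{E}=\{g_1,\dots,g_N\}$ be a complete multilinear $G$-poset, labelled so that $e_{ij}=0$ whenever $i<j$, where $e_{ij}=I(g_j)(g_i)$. Define $$c_{ij}^k=\sum_{h=1}^N(-1)^{|g_k|-|g_h|}e_{kh}e_{hi}e_{hj}.$$ Then $e_{ij}=c_{ij}^i$ for all $i,j$.
   Context: Let $G\le S_M$ act on variables $x_1,\dots,x_M$ by permuting indices. A multilinear monomial is $\prod_{i\in S}x_i$ for $S\subseteq\{1,\dots,M\}$; its degree $|g|$ is $|S|$. A complete multilinear $G$-poset is a set $\mathcal{E}$ of $G$-orbits of multilinear monomials (each represented by a monomial $g_i$) such that whenever a monomial $w$ lies in an orbit of $\mathcal{E}$, every monomial dividing $w$ lies in some orbit of $\mathcal{E}$. For monomials $g,w$, $I(g)(w)$ is the number of monomials in the $G$-orbit of $g$ that divide $w$ (this does not depend on the chosen representatives). In particular $e_{ii}=1$. -}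

module Defs where

open import Data.Nat using (ℕ; zero; suc)
open import Data.Fin using (Fin; zero; suc)
open import Data.Fin.Subset using (Subset; _⊆_; ∣_∣; inside; outside)
open import Data.Integer using () renaming (∣_∣ to absℤ)
open import Data.Fin.Subset.Properties using (_⊆?_)
open import Data.Fin.Permutation using (Permutation′; _⟨$⟩ʳ_; _⟨$⟩ˡ_; _∘ₚ_; flip; id)
open import Data.Vec using (Vec; []; _∷_; tabulate; lookup)
import Data.Vec.Properties as VP
open import Data.Bool.Properties using () renaming (_≟_ to _≟B_)
open import Data.List using (List; []; _∷_; _++_; map; filter; length; [_])
open import Data.List.Relation.Unary.Any using (Any; any?)
open import Data.Product using (_×_; Σ; ∃)
open import Data.Integer using (ℤ; +_; -_; _+_; _*_; _-_; _^_; -1ℤ; 0ℤ)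
open import Relation.Binary.PropositionalEquality using (_≡_; _≢_)
open import Relation.Nullary using (Dec; ¬_)
open import Relation.Nullary.Decidable using (_×-dec_)

-- A subgroup G ≤ S_M, given by a finite list of its elements (permutations
-- of Fin M); membership is up to pointwise equality of permutations.
_∈ₚ_ : {M : ℕ} → Permutation′ M → List (Permutation′ M) → Set
σ ∈ₚ G = Any (λ ρ → ∀ i → ρ ⟨$⟩ʳ i ≡ σ ⟨$⟩ʳ i) G

record PermGroup (M : ℕ) : Set where
  field
    elems   : List (Permutation′ M)
    has-id  : id ∈ₚ elems
    closed-∘ : ∀ σ τ → σ ∈ₚ elems → τ ∈ₚ elems → (σ ∘ₚ τ) ∈ₚ elems
    closed-⁻¹ : ∀ σ → σ ∈ₚ elems → flip σ ∈ₚ elems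
open PermGroup public

-- Multilinear monomials in x_1..x_M are subsets of Fin M; degree |S| = ∣ S ∣,
-- and divisibility of multilinear monomials is inclusion _⊆_.
Monomial : ℕ → Set
Monomial M = Subset M

deg : {M : ℕ} → Monomial M → ℕ
deg S = ∣ S ∣

-- permutation action on monomials: σ·S = { σ j | j ∈ S }
act : {M : ℕ} → Permutation′ M → Monomial M → Monomial M
act σ S = tabulate (λ i → lookup S (σ ⟨$⟩ˡ i))

InOrbit : {M : ℕ} → PermGroup M → Monomial M → Monomial M → Set
InOrbit G g S = Any (λ σ → act σ g ≡ S) (elems G)

InOrbit? : {M : ℕ} (G : PermGroup M) (g S : Monomial M) → Dec (InOrbit G g S)
InOrbit? G g S = any? (λ σ → VP.≡-dec _≟B_ (act σ g) S) (elems G)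

allMonomials : (M : ℕ) → List (Monomial M)
allMonomials zero = [ [] ]
allMonomials (suc M) = map (outside ∷_) (allMonomials M) ++ map (inside ∷_) (allMonomials M)

I : {M : ℕ} → PermGroup M → Monomial M → Monomial M → ℕ
I G g w = length (filter (λ S → InOrbit? G g S ×-dec (S ⊆? w)) (allMonomials M))
  where M = _

record CompleteMultilinearPoset {M : ℕ} (G : PermGroup M) : Set where
  field
    N        : ℕ
    g        : Fin N → Monomial M
    distinct : ∀ i j → i ≢ j → ¬ InOrbit G (g i) (g j)
    complete : ∀ i w → InOrbit G (g i) w → ∀ v → v ⊆ w → ∃ λ j → InOrbit G (g j) v
open CompleteMultilinearPoset public

signPow : ℤ → ℤ
signPow z = -1ℤ ^ absℤ z

Σℤ : (n : ℕ) → (Fin n → ℤ) → ℤ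
Σℤ zero f = 0ℤ
Σℤ (suc n) f = f zero + Σℤ n (λ i → f (suc i))

e : {M : ℕ} {G : PermGroup M} (E : CompleteMultilinearPoset G) → Fin (N E) → Fin (N E) → ℕ
e {G = G} E i j = I G (g E j) (g E i)

c : {M : ℕ} {G : PermGroup M} (E : CompleteMultilinearPoset G) → Fin (N E) → Fin (N E) → Fin (N E) → ℤ
c E k i j = Σℤ (N E) (λ h →
  signPow (+ deg (g E k) - + deg (g E h)) * (+ e E k h) * (+ e E h i) * (+ e E h j))

-- A conjugate S of g_h dividing g_i has degree |g_h| ≤ |g_i|; if moreover |g_i| ≤ |g_h|
-- then S = g_i, so g_i lies in the orbit of g_h. Since the orbits in E are distinct, this
-- gives e_ih · e_hi = 0 for h ≠ i, and trivially e_ii = 1. Hence the sum defining c^i_ij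
-- collapses to its term h = i, namely (-1)^0 · e_ii · e_ii · e_ij = e_ij.
module Submission where

open import Defs
open import Data.Nat using (ℕ; zero; suc; _≤_; _+_; s≤s)
import Data.Nat.Properties as ℕ
open import Data.Fin using (Fin; zero; suc; _<_)
import Data.Fin.Properties as Fin
open import Data.Integer using (+_)
import Data.Integer as ℤ
import Data.Integer.Properties as ℤ
open import Data.Bool using (Bool; if_then_else_)
open import Data.Fin.Subset using (Subset; _⊆_; ∣_∣; inside; outside)
open import Data.Fin.Subset.Properties using (_⊆?_; p⊆q⇒∣p∣≤∣q∣; drop-∷-⊆; ⊆-refl)
open import Data.Fin.Permutation using (Permutation′; _⟨$⟩ʳ_; _⟨$⟩ˡ_; flip; inverseʳ)
open import Data.Vec using ([]; _∷_; lookup; here)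
import Data.Vec.Properties as Vec
open import Data.List using ([]; _∷_; _++_; map; filter; length)
import Data.List.Properties as List
open import Data.List.Relation.Unary.All as All using ()
open import Data.List.Relation.Unary.Any as Any using (satisfied)
open import Data.Product using (_×_; _,_; ∃)
open import Data.Sum using (_⊎_; inj₁; inj₂) renaming (map to ⊎-map)
open import Data.Empty using (⊥-elim)
open import Function using (_∘_)
open import Level using (0ℓ)
open import Relation.Binary.PropositionalEquality
  using (_≡_; _≢_; refl; sym; trans; cong; cong₂; subst; module ≡-Reasoning)
open import Relation.Nullary using (yes; no; ¬_)
open import Relation.Nullary.Decidable using (_×-dec_)
open import Relation.Unary using (Pred; Decidable)
open import Algebra.Properties.CommutativeMonoid.Sum ℕ.+-0-commutativeMonoid
  using (sum; sum-cong-≗; sum-permute)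

open ≡-Reasoning

module _ {A : Set} {P : Pred A 0ℓ} (P? : Decidable P) where

  length-filter-none : (∀ x → ¬ P x) → ∀ xs → length (filter P? xs) ≡ 0
  length-filter-none ¬P xs = cong length (List.filter-none P? (All.universal ¬P xs))

  length-filter≢0⇒∃ : ∀ xs → length (filter P? xs) ≢ 0 → ∃ P
  length-filter≢0⇒∃ [] ne = ⊥-elim (ne refl)
  length-filter≢0⇒∃ (x ∷ xs) ne with P? x
  ... | yes px = x , px
  ... | no _   = length-filter≢0⇒∃ xs ne

length-filter-map : ∀ {A B : Set} {P : Pred B 0ℓ} (P? : Decidable P) (f : A → B) xs →
  length (filter P? (map f xs)) ≡ length (filter (P? ∘ f) xs)
length-filter-map P? f [] = refl
length-filter-map P? f (x ∷ xs) with P? (f x)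
... | yes _ = cong suc (length-filter-map P? f xs)
... | no _  = length-filter-map P? f xs

length-filter-allMonomials-suc : ∀ {M} {P : Pred (Monomial (suc M)) 0ℓ} (P? : Decidable P) →
  length (filter P? (allMonomials (suc M)))
    ≡ length (filter (P? ∘ (outside ∷_)) (allMonomials M))
      + length (filter (P? ∘ (inside ∷_)) (allMonomials M))
length-filter-allMonomials-suc {M} P? = begin
  length (filter P? (map (outside ∷_) ms ++ map (inside ∷_) ms))
    ≡⟨ cong length (List.filter-++ P? (map (outside ∷_) ms) _) ⟩
  length (filter P? (map (outside ∷_) ms) ++ filter P? (map (inside ∷_) ms))
    ≡⟨ List.length-++ (filter P? (map (outside ∷_) ms)) ⟩
  length (filter P? (map (outside ∷_) ms)) + length (filter P? (map (inside ∷_) ms))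
    ≡⟨ cong₂ _+_ (length-filter-map P? (outside ∷_) ms) (length-filter-map P? (inside ∷_) ms) ⟩
  length (filter (P? ∘ (outside ∷_)) ms) + length (filter (P? ∘ (inside ∷_)) ms) ∎
  where ms = allMonomials M

-- allMonomials lists every monomial exactly once.
length-filter-allMonomials-singleton :
  ∀ {M} {P : Pred (Monomial M) 0ℓ} (P? : Decidable P) {w} →
  (∀ {S} → P S → S ≡ w) → P w → length (filter P? (allMonomials M)) ≡ 1
length-filter-allMonomials-singleton {zero} P? {[]} _ Pw with P? []
... | yes _ = refl
... | no ¬Pw = ⊥-elim (¬Pw Pw)
length-filter-allMonomials-singleton {suc M} P? {outside ∷ w} only Pw =
  trans (length-filter-allMonomials-suc P?) (cong₂ _+_ present absent)
  where
  present : length (filter (P? ∘ (outside ∷_)) (allMonomials M)) ≡ 1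
  present = length-filter-allMonomials-singleton (P? ∘ (outside ∷_)) (Vec.∷-injectiveʳ ∘ only) Pw
  absent : length (filter (P? ∘ (inside ∷_)) (allMonomials M)) ≡ 0
  absent = length-filter-none (P? ∘ (inside ∷_)) (λ _ p → inside≢outside (only p)) (allMonomials M)
    where
    inside≢outside : ∀ {x} → inside ∷ x ≢ outside ∷ w
    inside≢outside ()
length-filter-allMonomials-singleton {suc M} P? {inside ∷ w} only Pw =
  trans (length-filter-allMonomials-suc P?) (cong₂ _+_ absent present)
  where
  present : length (filter (P? ∘ (inside ∷_)) (allMonomials M)) ≡ 1
  present = length-filter-allMonomials-singleton (P? ∘ (inside ∷_)) (Vec.∷-injectiveʳ ∘ only) Pw
  absent : length (filter (P? ∘ (outside ∷_)) (allMonomials M)) ≡ 0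
  absent = length-filter-none (P? ∘ (outside ∷_)) (λ _ p → inside≢outside (only p)) (allMonomials M)
    where
    inside≢outside : ∀ {x} → outside ∷ x ≢ inside ∷ w
    inside≢outside ()

p⊆q⇒∣q∣≤∣p∣⇒p≡q : ∀ {n} {p q : Subset n} → p ⊆ q → ∣ q ∣ ≤ ∣ p ∣ → p ≡ q
p⊆q⇒∣q∣≤∣p∣⇒p≡q {p = []}          {[]}          _   _ = refl
p⊆q⇒∣q∣≤∣p∣⇒p≡q {p = outside ∷ p} {outside ∷ q} p⊆q c =
  cong (outside ∷_) (p⊆q⇒∣q∣≤∣p∣⇒p≡q (drop-∷-⊆ p⊆q) c)
p⊆q⇒∣q∣≤∣p∣⇒p≡q {p = outside ∷ p} {inside ∷ q}  p⊆q c =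
  ⊥-elim (ℕ.<⇒≱ (s≤s (p⊆q⇒∣p∣≤∣q∣ (drop-∷-⊆ p⊆q))) c)
p⊆q⇒∣q∣≤∣p∣⇒p≡q {p = inside ∷ p}  {outside ∷ q} p⊆q _ with p⊆q here
... | ()
p⊆q⇒∣q∣≤∣p∣⇒p≡q {p = inside ∷ p}  {inside ∷ q}  p⊆q c =
  cong (inside ∷_) (p⊆q⇒∣q∣≤∣p∣⇒p≡q (drop-∷-⊆ p⊆q) (ℕ.≤-pred c))

∣p∣≡sum : ∀ {n} (p : Subset n) → ∣ p ∣ ≡ sum (λ i → if lookup p i then 1 else 0)
∣p∣≡sum []          = refl
∣p∣≡sum (inside ∷ p)  = cong suc (∣p∣≡sum p)
∣p∣≡sum (outside ∷ p) = ∣p∣≡sum p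

deg-act : ∀ {M} (σ : Permutation′ M) (S : Monomial M) → deg (act σ S) ≡ deg S
deg-act σ S = begin
  ∣ act σ S ∣                                        ≡⟨ ∣p∣≡sum (act σ S) ⟩
  sum (λ i → indicator (lookup (act σ S) i))         ≡⟨ sum-cong-≗ (cong indicator ∘ Vec.lookup∘tabulate (lookup S ∘ (σ ⟨$⟩ˡ_))) ⟩
  sum (λ i → indicator (lookup S (σ ⟨$⟩ˡ i)))        ≡⟨ sum-permute (indicator ∘ lookup S) (flip σ) ⟨
  sum (λ i → indicator (lookup S i))                 ≡⟨ ∣p∣≡sum S ⟨
  ∣ S ∣                                              ∎
  where
  indicator : Bool → ℕ
  indicator b = if b then 1 else 0

module _ {M : ℕ} (G : PermGroup M) where

  InOrbit⇒deg≡ : ∀ g {S} → InOrbit G g S → deg S ≡ deg g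
  InOrbit⇒deg≡ g o with satisfied o
  ... | σ , σg≡S = trans (cong deg (sym σg≡S)) (deg-act σ g)

  InOrbit-refl : ∀ g → InOrbit G g g
  InOrbit-refl g = Any.map (λ {ρ} → fixes {ρ}) (has-id G)
    where
    fixes : ∀ {ρ} → (∀ i → ρ ⟨$⟩ʳ i ≡ i) → act ρ g ≡ g
    fixes {ρ} ρ≡id = trans
      (Vec.tabulate-cong (λ i → cong (lookup g) (trans (sym (ρ≡id (ρ ⟨$⟩ˡ i))) (inverseʳ ρ))))
      (Vec.tabulate∘lookup g)

  I≢0⇒∃divisor : ∀ g w → I G g w ≢ 0 → ∃ λ S → InOrbit G g S × S ⊆ w
  I≢0⇒∃divisor g w = length-filter≢0⇒∃ (λ S → InOrbit? G g S ×-dec (S ⊆? w)) (allMonomials M)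

  I≢0⇒deg≤ : ∀ g w → I G g w ≢ 0 → deg g ≤ deg w
  I≢0⇒deg≤ g w ne with I≢0⇒∃divisor g w ne
  ... | S , o , S⊆w = subst (_≤ deg w) (InOrbit⇒deg≡ g o) (p⊆q⇒∣p∣≤∣q∣ S⊆w)

  I≢0⇒I≢0⇒InOrbit : ∀ g w → I G g w ≢ 0 → I G w g ≢ 0 → InOrbit G g w
  I≢0⇒I≢0⇒InOrbit g w ne ne′ with I≢0⇒∃divisor g w ne
  ... | S , o , S⊆w = subst (InOrbit G g) S≡w o
    where
    S≡w : S ≡ w
    S≡w = p⊆q⇒∣q∣≤∣p∣⇒p≡q S⊆w (subst (deg w ≤_) (sym (InOrbit⇒deg≡ g o)) (I≢0⇒deg≤ w g ne′))

  I-self : ∀ g → I G g g ≡ 1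
  I-self g = length-filter-allMonomials-singleton (λ S → InOrbit? G g S ×-dec (S ⊆? g))
    (λ (o , S⊆g) → p⊆q⇒∣q∣≤∣p∣⇒p≡q S⊆g (ℕ.≤-reflexive (sym (InOrbit⇒deg≡ g o))))
    (InOrbit-refl g , ⊆-refl)

module _ {M : ℕ} {G : PermGroup M} (E : CompleteMultilinearPoset G) where

  e-diagonal : ∀ i → e E i i ≡ 1
  e-diagonal i = I-self G (g E i)

  e-off-diagonal : ∀ i h → h ≢ i → e E i h ≡ 0 ⊎ e E h i ≡ 0
  e-off-diagonal i h h≢i with e E i h ℕ.≟ 0 | e E h i ℕ.≟ 0
  ... | yes e≡0 | _       = inj₁ e≡0
  ... | no _    | yes e≡0 = inj₂ e≡0
  ... | no ne   | no ne′  = ⊥-elim (distinct E h i h≢i (I≢0⇒I≢0⇒InOrbit G (g E h) (g E i) ne ne′))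

Σℤ-zero : ∀ n (f : Fin n → ℤ.ℤ) → (∀ h → f h ≡ ℤ.0ℤ) → Σℤ n f ≡ ℤ.0ℤ
Σℤ-zero zero    f f≡0 = refl
Σℤ-zero (suc n) f f≡0 = cong₂ ℤ._+_ (f≡0 zero) (Σℤ-zero n (f ∘ suc) (f≡0 ∘ suc))

Σℤ-single : ∀ n (f : Fin n → ℤ.ℤ) k → (∀ h → h ≢ k → f h ≡ ℤ.0ℤ) → Σℤ n f ≡ f k
Σℤ-single (suc n) f zero f≡0 = begin
  f zero ℤ.+ Σℤ n (f ∘ suc)  ≡⟨ cong (λ x → f zero ℤ.+ x) (Σℤ-zero n (f ∘ suc) (λ h → f≡0 _ λ ())) ⟩
  f zero ℤ.+ ℤ.0ℤ            ≡⟨ ℤ.+-identityʳ _ ⟩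
  f zero                     ∎
Σℤ-single (suc n) f (suc k) f≡0 = begin
  f zero ℤ.+ Σℤ n (f ∘ suc)  ≡⟨ cong (ℤ._+ Σℤ n (f ∘ suc)) (f≡0 zero λ ()) ⟩
  ℤ.0ℤ ℤ.+ Σℤ n (f ∘ suc)    ≡⟨ ℤ.+-identityˡ _ ⟩
  Σℤ n (f ∘ suc)             ≡⟨ Σℤ-single n (f ∘ suc) k (λ h h≢k → f≡0 _ (h≢k ∘ Fin.suc-injective)) ⟩
  f (suc k)                  ∎

*-zero-middle : ∀ s a b c → a ≡ ℤ.0ℤ ⊎ b ≡ ℤ.0ℤ → s ℤ.* a ℤ.* b ℤ.* c ≡ ℤ.0ℤ
*-zero-middle s a b c (inj₁ refl) rewrite ℤ.*-zeroʳ s = refl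
*-zero-middle s a b c (inj₂ refl) rewrite ℤ.*-zeroʳ (s ℤ.* a) = refl

proposition13 : {M : ℕ} (G : PermGroup M) (E : CompleteMultilinearPoset G) →
    (∀ i j → i < j → e E i j ≡ 0) →
    ∀ i j → + e E i j ≡ c E i i j
proposition13 G E _ i j = sym (begin
  c E i i j                             ≡⟨ Σℤ-single (N E) term i off-diagonal ⟩
  term i                                ≡⟨ cong₂ (λ s ε → s ℤ.* ε ℤ.* ε ℤ.* + e E i j)
                                                 sign-i (cong (λ n → + n) (e-diagonal E i)) ⟩
  ℤ.1ℤ ℤ.* ℤ.1ℤ ℤ.* ℤ.1ℤ ℤ.* + e E i j  ≡⟨ ℤ.*-identityˡ _ ⟩
  + e E i j                             ∎)
  where
  sign : Fin (N E) → ℤ.ℤ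
  sign h = signPow (+ deg (g E i) ℤ.- + deg (g E h))

  term : Fin (N E) → ℤ.ℤ
  term h = sign h ℤ.* + e E i h ℤ.* + e E h i ℤ.* + e E h j

  sign-i : sign i ≡ ℤ.1ℤ
  sign-i = cong signPow (ℤ.+-inverseʳ (+ deg (g E i)))

  off-diagonal : ∀ h → h ≢ i → term h ≡ ℤ.0ℤ
  off-diagonal h h≢i = *-zero-middle (sign h) (+ e E i h) (+ e E h i) (+ e E h j)
    (⊎-map (cong (λ n → + n)) (cong (λ n → + n)) (e-off-diagonal E i h h≢i))
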